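{- Let $c\geq1$ be an integer, $k$ a constant, $H=(V,E)$ a hypergraph, $\gamma\colon E\to[0,1]$, and $(\mathbf{S},U)$ a well-formed pair. If the optimal value of $LP(\mathbf{S},U)$ is at most $k$, then $(\mathbf{S},U)$ is a perfect pair.
   Context: A hypergraph $H=(V,E)$ has a finite vertex set $V$ and a set $E$ of non-empty subsets of $V$. For $\gamma\colon E\to[0,1]$: $B(\gamma)=\{v\mid\sum_{e\ni v}\gamma(e)\geq1\}$, $\operatorname{support}(\gamma)=\{e\mid\gamma(e)\neq0\}$, $\operatorname{weight}(\gamma)=\sum_e\gamma(e)$. $\bigcap S$ / $\bigcup S$ denote the vertices in all / some edges of a set $S$ of edges; $\bigcup\mathbf{S}$ for a collection $\mathbf{S}$ of sets of edges denotes the set of all edges occurring in some member of $\mathbf{S}$ when used as a set of edges. A pair $(\mathbf{S},U)$ is well-formed if (1) $U\subseteq B(\gamma)$, (2) $\mathbf{S}=\{S_1,\dots,S_r\}$ is a finite collection of sets each of at most $c$ edges, (3) $B(\gamma)\setminus U\subseteq\bigcup_i\bigcap S_i$; its size is $n(\mathbf{S},U)=\sum_i|S_i|+2^{|U|}$; it is perfect if some $\nu\colon E\to[0,1]$ has $\operatorname{weight}(\nu)\leq k$, $|\operatorname{support}(\nu)|\leq n(\mathbf{S},U)$ and $\bigcup_i\bigcap S_i\cup U\subseteq B(\nu)$. A set $U'\subseteq U$ is a working set if there is an edge $e\in E\setminus\bigcup\mathbf{S}$ (edges not belonging to any $S_i$) with $e\cap U=U'$; such $e$ is a witnessing edge of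 $U'$, and $W_{U'}$ is the set of all of them. Fix one representative in each $W_{U'}$ for non-empty working sets $U'$; $A_U$ is the set of these representatives. $LP(\mathbf{S},U)$ has variables $x_e\geq 0$ for $e\in\bigcup\mathbf{S}\cup A_U$, objective: minimize $\sum x_e$, and constraints $\sum_{e\in S}x_e\geq1$ for every $S\in\mathbf{S}$, and $\sum_{e\in E_u}x_e\geq1$ for every $u\in U$, where $E_u$ is the set of edges in $\bigcup\mathbf{S}\cup A_U$ containing $u$.
   Formalization: The map γ takes values in the rationals of [0,1], the constant k is rational, feasible solutions of $LP(\mathbf{S},U)$ have rational entries, and the map ν is taken in the rationals as well. -}

module Defs where

open import Data.Nat as ℕ using (ℕ; zero; suc; _^_)
open import Data.Fin using (Fin; zero; suc)
open import Data.Fin.Subset using (Subset; _∈_; _∉_; _∩_; Nonempty; ∣_∣)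
open import Data.Fin.Subset.Properties using (_∈?_)
open import Data.Rational using (ℚ; 0ℚ; 1ℚ; _+_; _≤_)
open import Data.Rational.Properties using (_≟_)
open import Data.Vec using (tabulate)
open import Data.Bool using (if_then_else_; not)
open import Data.Product using (Σ; ∃; _×_; _,_)
open import Data.Sum using (_⊎_)
open import Relation.Nullary using (does; ¬_)
open import Relation.Binary.PropositionalEquality using (_≡_; _≢_)
open import Function.Definitions using (Injective)

sumFin : ∀ {m} → (Fin m → ℚ) → ℚ
sumFin {zero}  f = 0ℚ
sumFin {suc m} f = f zero + sumFin (λ i → f (suc i))

sumOver : ∀ {m} → Subset m → (Fin m → ℚ) → ℚ
sumOver S f = sumFin (λ e → if does (e ∈? S) then f e else 0ℚ)

-- A hypergraph on vertex set Fin n with edges indexed by Fin m: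
-- edges are non-empty and pairwise distinct (E is a *set* of subsets).
record IsHypergraph {n m : ℕ} (edge : Fin m → Subset n) : Set where
  field
    nonempty : ∀ e → Nonempty (edge e)
    distinct : Injective _≡_ _≡_ edge

UnitValued : ∀ {m} → (Fin m → ℚ) → Set
UnitValued γ = ∀ e → (0ℚ ≤ γ e) × (γ e ≤ 1ℚ)

InB : ∀ {n m} → (Fin m → Subset n) → (Fin m → ℚ) → Fin n → Set
InB edge γ v = 1ℚ ≤ sumFin (λ e → if does (v ∈? edge e) then γ e else 0ℚ)

support : ∀ {m} → (Fin m → ℚ) → Subset m
support ν = tabulate (λ e → not (does (ν e ≟ 0ℚ)))

weight : ∀ {m} → (Fin m → ℚ) → ℚ
weight = sumFin

In⋂ : ∀ {n m} → (Fin m → Subset n) → Subset m → Fin n → Set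
In⋂ edge S v = ∀ e → e ∈ S → v ∈ edge e

In⋃⋂ : ∀ {n m r} → (Fin m → Subset n) → (Fin r → Subset m) → Fin n → Set
In⋃⋂ edge 𝐒 v = ∃ λ i → In⋂ edge (𝐒 i) v

In⋃𝐒 : ∀ {m r} → (Fin r → Subset m) → Fin m → Set
In⋃𝐒 𝐒 e = ∃ λ i → e ∈ 𝐒 i

sumSizes : ∀ {m r} → (Fin r → Subset m) → ℕ
sumSizes {r = zero}  𝐒 = 0
sumSizes {r = suc r} 𝐒 = ∣ 𝐒 zero ∣ ℕ.+ sumSizes (λ i → 𝐒 (suc i))

size : ∀ {n m r} → (Fin r → Subset m) → Subset n → ℕ
size 𝐒 U = sumSizes 𝐒 ℕ.+ (2 ^ ∣ U ∣)

-- (𝐒,U) well-formed w.r.t. γ; the collection 𝐒 = {S_1,…,S_r} is given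
-- by an injective family (so its members are distinct).
record WellFormed {n m r : ℕ} (c : ℕ) (edge : Fin m → Subset n) (γ : Fin m → ℚ)
                  (𝐒 : Fin r → Subset m) (U : Subset n) : Set where
  field
    U⊆B      : ∀ v → v ∈ U → InB edge γ v
    distinct : Injective _≡_ _≡_ 𝐒
    small    : ∀ i → ∣ 𝐒 i ∣ ℕ.≤ c
    covers   : ∀ v → InB edge γ v → v ∉ U → In⋃⋂ edge 𝐒 v

Perfect : ∀ {n m r} → ℚ → (Fin m → Subset n) → (Fin r → Subset m) → Subset n → Set
Perfect {n} {m} k edge 𝐒 U =
  Σ (Fin m → ℚ) λ ν →
    UnitValued ν × (weight ν ≤ k) × (∣ support ν ∣ ℕ.≤ size 𝐒 U)
    × (∀ v → (In⋃⋂ edge 𝐒 v ⊎ v ∈ U) → InB edge ν v)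

-- e is a witnessing edge of a working set: e ∉ ⋃𝐒.
-- A_U: a set of edges containing exactly one representative of W_{U'} for
-- each non-empty working set U' (and nothing else).
record IsRepresentativeSet {n m r : ℕ} (edge : Fin m → Subset n)
        (𝐒 : Fin r → Subset m) (U : Subset n) (A : Subset m) : Set where
  field
    witnessing : ∀ a → a ∈ A → ¬ In⋃𝐒 𝐒 a
    nonemptyWS : ∀ a → a ∈ A → Nonempty (edge a ∩ U)
    unique     : ∀ a b → a ∈ A → b ∈ A → edge a ∩ U ≡ edge b ∩ U → a ≡ b
    complete   : ∀ e → ¬ In⋃𝐒 𝐒 e → Nonempty (edge e ∩ U) →
                 ∃ λ a → a ∈ A × (edge a ∩ U ≡ edge e ∩ U)

-- Variables of LP(𝐒,U): edges in ⋃𝐒 ∪ A_U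
InDom : ∀ {m r} → (Fin r → Subset m) → Subset m → Fin m → Set
InDom 𝐒 A e = In⋃𝐒 𝐒 e ⊎ e ∈ A

-- x : E → ℚ is a feasible solution of LP(𝐒,U) (variables outside the
-- domain are fixed to 0, so that sums over E are sums over the variables).
record LPFeasible {n m r : ℕ} (edge : Fin m → Subset n) (𝐒 : Fin r → Subset m)
       (U : Subset n) (A : Subset m) (x : Fin m → ℚ) : Set where
  field
    nonneg    : ∀ e → 0ℚ ≤ x e
    outside   : ∀ e → ¬ InDom 𝐒 A e → x e ≡ 0ℚ
    coverS    : ∀ i → 1ℚ ≤ sumOver (𝐒 i) x
    coverU    : ∀ u → u ∈ U → 1ℚ ≤ sumFin (λ e → if does (u ∈? edge e) then x e else 0ℚ)

-- optimal value of LP(𝐒,U) is ≤ k  (LP optimum is attained when finite)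
LPOptAtMost : ∀ {n m r} → (Fin m → Subset n) → (Fin r → Subset m) → Subset n →
              Subset m → ℚ → Set
LPOptAtMost edge 𝐒 U A k = ∃ λ x → LPFeasible edge 𝐒 U A x × (sumFin x ≤ k)

{-# OPTIONS --safe #-}
-- Truncating an optimal LP solution x pointwise at 1 gives ν. Since ν ≤ x its weight is at most k,
-- and since (a + b) ⊓ 1 ≤ a ⊓ 1 + b ⊓ 1 for a, b ≥ 0, ν still satisfies every covering constraint
-- of the LP; a vertex of ⋂ Sᵢ lies in every edge of Sᵢ, so it is covered as well. The support of ν
-- lies among the LP variables ⋃𝐒 ∪ A_U, where |⋃𝐒| ≤ Σᵢ |Sᵢ| and |A_U| ≤ 2^|U| because distinct
-- representatives have distinct traces e ∩ U ⊆ U.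
module Submission where

open import Defs
open import Data.Nat as ℕ using (ℕ; zero; suc; _^_; _≥_; z≤n; s≤s)
import Data.Nat.Properties as ℕ
open import Data.Bool using (Bool; true; false; if_then_else_; not)
open import Data.Bool.Properties using (¬-not)
open import Data.Fin using (Fin; zero; suc)
open import Data.Fin.Subset
open import Data.Fin.Subset.Properties
open import Data.List using (tabulate)
open import Data.Vec as Vec using (Vec; []; _∷_; head; tail; here)
open import Data.Vec.Properties using (lookup∘tabulate; []=⇒lookup; lookup⇒[]=)
open import Data.Product using (_,_; proj₁; proj₂)
open import Function using (_∘_)
open import Data.Sum using (_⊎_; inj₁; inj₂)
open import Data.Rational using (ℚ; 0ℚ; 1ℚ; _⊓_) renaming (_≤_ to _≤ℚ_; _+_ to _+ℚ_)
import Data.Rational.Properties as ℚ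
open import Relation.Nullary using (¬_; does; yes; no; contradiction)
open import Level using (0ℓ)
open import Relation.Unary using (Pred; Decidable) renaming (_⊆_ to _⇒_)
open import Relation.Binary.PropositionalEquality

private
  variable
    m n : ℕ

InjectiveOn : ∀ {B : Set} → (Fin m → B) → Subset m → Set
InjectiveOn f A = ∀ {a b} → a ∈ A → b ∈ A → f a ≡ f b → a ≡ b

∈-tabulate⁻ : ∀ {f : Fin m → Bool} {a} → a ∈ Vec.tabulate f → f a ≡ true
∈-tabulate⁻ {f = f} {a} a∈ = trans (sym (lookup∘tabulate f a)) ([]=⇒lookup a∈)

∉-tabulate⁻ : ∀ {f : Fin m → Bool} {a} → a ∉ Vec.tabulate f → f a ≡ false
∉-tabulate⁻ {f = f} {a} a∉ =
  ¬-not (λ fa≡true → a∉ (lookup⇒[]= a _ (trans (lookup∘tabulate f a) fa≡true)))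

∣p∣≤1 : ∀ {p : Subset m} → (∀ {a b} → a ∈ p → b ∈ p → a ≡ b) → ∣ p ∣ ℕ.≤ 1
∣p∣≤1 {m} {p} unique with nonempty? p
... | no  empty     = ℕ.m≤n⇒m≤1+n (ℕ.≤-reflexive (trans (cong ∣_∣ (Empty-unique empty)) (∣⊥∣≡0 m)))
... | yes (x , x∈p) = ℕ.≤-trans (p⊆q⇒∣p∣≤∣q∣ p⊆⁅x⁆) (ℕ.≤-reflexive (∣⁅x⁆∣≡1 x))
  where
  p⊆⁅x⁆ : p ⊆ ⁅ x ⁆
  p⊆⁅x⁆ y∈p = subst (_∈ ⁅ x ⁆) (unique x∈p y∈p) (x∈⁅x⁆ x)

∣p∪q∣≤∣p∣+∣q∣ : ∀ (p q : Subset m) → ∣ p ∪ q ∣ ℕ.≤ ∣ p ∣ ℕ.+ ∣ q ∣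
∣p∪q∣≤∣p∣+∣q∣ []            []            = z≤n
∣p∪q∣≤∣p∣+∣q∣ (inside  ∷ p) (s       ∷ q) =
  s≤s (ℕ.≤-trans (∣p∪q∣≤∣p∣+∣q∣ p q) (ℕ.+-monoʳ-≤ ∣ p ∣ (∣p∣≤∣x∷p∣ s q)))
∣p∪q∣≤∣p∣+∣q∣ (outside ∷ p) (inside  ∷ q) =
  ℕ.≤-trans (s≤s (∣p∪q∣≤∣p∣+∣q∣ p q)) (ℕ.≤-reflexive (sym (ℕ.+-suc ∣ p ∣ ∣ q ∣)))
∣p∪q∣≤∣p∣+∣q∣ (outside ∷ p) (outside ∷ q) = ∣p∪q∣≤∣p∣+∣q∣ p q

∣p∣≡∣p∩q∣+∣p∩∁q∣ : ∀ (p q : Subset m) → ∣ p ∣ ≡ ∣ p ∩ q ∣ ℕ.+ ∣ p ∩ ∁ q ∣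
∣p∣≡∣p∩q∣+∣p∩∁q∣ []            []            = refl
∣p∣≡∣p∩q∣+∣p∩∁q∣ (outside ∷ p) (_       ∷ q) = ∣p∣≡∣p∩q∣+∣p∩∁q∣ p q
∣p∣≡∣p∩q∣+∣p∩∁q∣ (inside  ∷ p) (inside  ∷ q) = cong suc (∣p∣≡∣p∩q∣+∣p∩∁q∣ p q)
∣p∣≡∣p∩q∣+∣p∩∁q∣ (inside  ∷ p) (outside ∷ q) =
  trans (cong suc (∣p∣≡∣p∩q∣+∣p∩∁q∣ p q)) (sym (ℕ.+-suc ∣ p ∩ q ∣ ∣ p ∩ ∁ q ∣))

head-tail-injective : ∀ {A : Set} {xs ys : Vec A (suc n)} →
                      head xs ≡ head ys → tail xs ≡ tail ys → xs ≡ ys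
head-tail-injective {xs = _ ∷ _} {ys = _ ∷ _} = cong₂ _∷_

tail-⊆ : ∀ {p : Subset (suc n)} {s q} → p ⊆ s ∷ q → tail p ⊆ q
tail-⊆ {p = _ ∷ _} = drop-∷-⊆

head-⊆-outside : ∀ {p : Subset (suc n)} {q} → p ⊆ outside ∷ q → head p ≡ outside
head-⊆-outside {p = outside ∷ _} _   = refl
head-⊆-outside {p = inside  ∷ _} p⊆q with p⊆q here
... | ()

tail-injectiveOn : ∀ {K : Fin m → Subset (suc n)} {A} →
                   (∀ {a b} → a ∈ A → b ∈ A → head (K a) ≡ head (K b)) →
                   InjectiveOn K A → InjectiveOn (tail ∘ K) A
tail-injectiveOn same-head inj a∈ b∈ eq = inj a∈ b∈ (head-tail-injective (same-head a∈ b∈) eq)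

∣A∣≤2^∣U∣ : ∀ (K : Fin m → Subset n) (U : Subset n) (A : Subset m) →
            (∀ {a} → a ∈ A → K a ⊆ U) → InjectiveOn K A → ∣ A ∣ ℕ.≤ 2 ^ ∣ U ∣
∣A∣≤2^∣U∣ K [] A _ inj = ∣p∣≤1 (λ a∈ b∈ → inj a∈ b∈ (Vec0≡ (K _) (K _)))
  where
  Vec0≡ : (p q : Subset 0) → p ≡ q
  Vec0≡ [] [] = refl
∣A∣≤2^∣U∣ K (outside ∷ U) A K⊆U inj =
  ∣A∣≤2^∣U∣ (tail ∘ K) U A (tail-⊆ ∘ K⊆U)
    (tail-injectiveOn (λ a∈ b∈ → trans (head-⊆-outside (K⊆U a∈)) (sym (head-⊆-outside (K⊆U b∈))))
                      inj)
∣A∣≤2^∣U∣ K (inside ∷ U) A K⊆U inj = begin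
  ∣ A ∣                          ≡⟨ ∣p∣≡∣p∩q∣+∣p∩∁q∣ A H ⟩
  ∣ A ∩ H ∣ ℕ.+ ∣ A ∩ ∁ H ∣      ≤⟨ ℕ.+-mono-≤ (bound H ∈-tabulate⁻)
                                                 (bound (∁ H) (λ a∈ → ∉-tabulate⁻ (x∈∁p⇒x∉p a∈))) ⟩
  2 ^ ∣ U ∣ ℕ.+ 2 ^ ∣ U ∣        ≡⟨ cong (2 ^ ∣ U ∣ ℕ.+_) (sym (ℕ.+-identityʳ _)) ⟩
  2 ^ ∣ inside ∷ U ∣             ∎
  where
  open ℕ.≤-Reasoning
  H : Subset _
  H = Vec.tabulate (head ∘ K)
  bound : ∀ (B : Subset _) {s} → (∀ {a} → a ∈ B → head (K a) ≡ s) → ∣ A ∩ B ∣ ℕ.≤ 2 ^ ∣ U ∣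
  bound B head≡s = ∣A∣≤2^∣U∣ (tail ∘ K) U (A ∩ B) (λ a∈ → tail-⊆ (K⊆U (in-A a∈)))
    (tail-injectiveOn (λ a∈ b∈ → trans (head≡s (in-B a∈)) (sym (head≡s (in-B b∈))))
                      (λ a∈ b∈ → inj (in-A a∈) (in-A b∈)))
    where
    in-A : ∀ {a} → a ∈ A ∩ B → a ∈ A
    in-A = proj₁ ∘ x∈p∩q⁻ A B
    in-B : ∀ {a} → a ∈ A ∩ B → a ∈ B
    in-B = proj₂ ∘ x∈p∩q⁻ A B

∈⋃-tabulate : ∀ {r} (𝐒 : Fin r → Subset m) {i e} → e ∈ 𝐒 i → e ∈ ⋃ (tabulate 𝐒)
∈⋃-tabulate 𝐒 {zero}  e∈ = p⊆p∪q _ e∈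
∈⋃-tabulate 𝐒 {suc i} e∈ = q⊆p∪q (𝐒 zero) _ (∈⋃-tabulate (𝐒 ∘ suc) e∈)

∣⋃-tabulate∣≤sumSizes : ∀ {r} (𝐒 : Fin r → Subset m) → ∣ ⋃ (tabulate 𝐒) ∣ ℕ.≤ sumSizes 𝐒
∣⋃-tabulate∣≤sumSizes {m} {zero}    𝐒 = ℕ.≤-reflexive (∣⊥∣≡0 m)
∣⋃-tabulate∣≤sumSizes {r = suc r} 𝐒 = ℕ.≤-trans (∣p∪q∣≤∣p∣+∣q∣ (𝐒 zero) _)
  (ℕ.+-monoʳ-≤ ∣ 𝐒 zero ∣ (∣⋃-tabulate∣≤sumSizes (𝐒 ∘ suc)))

∈support⇒≢0 : ∀ {f : Fin m → ℚ} {e} → e ∈ support f → f e ≢ 0ℚ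
∈support⇒≢0 {f = f} {e} e∈ with f e ℚ.≟ 0ℚ | ∈-tabulate⁻ {f = λ e → not (does (f e ℚ.≟ 0ℚ))} e∈
... | yes _   | ()
... | no  f≢0 | _  = f≢0

support-⊆ : ∀ {f : Fin m → ℚ} {D} → (∀ e → e ∉ D → f e ≡ 0ℚ) → support f ⊆ D
support-⊆ {f = f} {D} vanishes {e} e∈ with e ∈? D
... | yes e∈D = e∈D
... | no  e∉D = contradiction (vanishes e e∉D) (∈support⇒≢0 {f = f} e∈)

AllNonNegative : (Fin m → ℚ) → Set
AllNonNegative f = ∀ e → 0ℚ ≤ℚ f e

-- The sums in sumOver and InB are, definitionally, sumFin (mask (_∈? S) f)
-- and sumFin (mask (λ e → v ∈? edge e) f).
mask : ∀ {P : Pred (Fin m) 0ℓ} → Decidable P → (Fin m → ℚ) → Fin m → ℚ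
mask P? f e = if does (P? e) then f e else 0ℚ

truncate : (Fin m → ℚ) → Fin m → ℚ
truncate f e = f e ⊓ 1ℚ

0≤1 : 0ℚ ≤ℚ 1ℚ
0≤1 = ℚ.nonNegative⁻¹ 1ℚ

sumFin-mono : ∀ {f g : Fin m → ℚ} → (∀ e → f e ≤ℚ g e) → sumFin f ≤ℚ sumFin g
sumFin-mono {zero}  f≤g = ℚ.≤-refl
sumFin-mono {suc m} f≤g = ℚ.+-mono-≤ (f≤g zero) (sumFin-mono (f≤g ∘ suc))

sumFin-nonneg : ∀ {f : Fin m → ℚ} → AllNonNegative f → 0ℚ ≤ℚ sumFin f
sumFin-nonneg {zero}  f≥0 = ℚ.≤-refl
sumFin-nonneg {suc m} f≥0 = ℚ.+-mono-≤ (f≥0 zero) (sumFin-nonneg (f≥0 ∘ suc))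

mask-nonneg : ∀ {P : Pred (Fin m) 0ℓ} (P? : Decidable P) {f} → AllNonNegative f → AllNonNegative (mask P? f)
mask-nonneg P? f≥0 e with does (P? e)
... | true  = f≥0 e
... | false = ℚ.≤-refl

mask-mono : ∀ {P Q : Pred (Fin m) 0ℓ} (P? : Decidable P) (Q? : Decidable Q) {f} →
            P ⇒ Q → AllNonNegative f → ∀ e → mask P? f e ≤ℚ mask Q? f e
mask-mono P? Q? P⇒Q f≥0 e with P? e | Q? e
... | yes _  | yes _  = ℚ.≤-refl
... | yes Pe | no ¬Qe = contradiction (P⇒Q Pe) ¬Qe
... | no  _  | yes _  = f≥0 e
... | no  _  | no  _  = ℚ.≤-refl

truncate-mask : ∀ {P : Pred (Fin m) 0ℓ} (P? : Decidable P) f e →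
                truncate (mask P? f) e ≡ mask P? (truncate f) e
truncate-mask P? f e with does (P? e)
... | true  = refl
... | false = ℚ.p≤q⇒p⊓q≡p 0≤1

truncate-nonneg : ∀ {f : Fin m → ℚ} → AllNonNegative f → AllNonNegative (truncate f)
truncate-nonneg f≥0 e = ℚ.⊓-glb (f≥0 e) 0≤1

⊓1-subadditive : ∀ {a b} → 0ℚ ≤ℚ a → 0ℚ ≤ℚ b → (a +ℚ b) ⊓ 1ℚ ≤ℚ a ⊓ 1ℚ +ℚ b ⊓ 1ℚ
⊓1-subadditive {a} {b} a≥0 b≥0 with ℚ.≤-total 1ℚ a | ℚ.≤-total 1ℚ b
... | inj₁ 1≤a | _ = begin
  (a +ℚ b) ⊓ 1ℚ      ≤⟨ ℚ.p⊓q≤q (a +ℚ b) 1ℚ ⟩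
  1ℚ +ℚ 0ℚ           ≤⟨ ℚ.+-monoʳ-≤ 1ℚ (ℚ.⊓-glb b≥0 0≤1) ⟩
  1ℚ +ℚ b ⊓ 1ℚ       ≡⟨ cong (_+ℚ b ⊓ 1ℚ) (sym (ℚ.p≥q⇒p⊓q≡q 1≤a)) ⟩
  a ⊓ 1ℚ +ℚ b ⊓ 1ℚ   ∎
  where open ℚ.≤-Reasoning
... | inj₂ _   | inj₁ 1≤b = begin
  (a +ℚ b) ⊓ 1ℚ      ≤⟨ ℚ.p⊓q≤q (a +ℚ b) 1ℚ ⟩
  0ℚ +ℚ 1ℚ           ≤⟨ ℚ.+-monoˡ-≤ 1ℚ (ℚ.⊓-glb a≥0 0≤1) ⟩
  a ⊓ 1ℚ +ℚ 1ℚ       ≡⟨ cong (a ⊓ 1ℚ +ℚ_) (sym (ℚ.p≥q⇒p⊓q≡q 1≤b)) ⟩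
  a ⊓ 1ℚ +ℚ b ⊓ 1ℚ   ∎
  where open ℚ.≤-Reasoning
... | inj₂ a≤1 | inj₂ b≤1 = begin
  (a +ℚ b) ⊓ 1ℚ      ≤⟨ ℚ.p⊓q≤p (a +ℚ b) 1ℚ ⟩
  a +ℚ b             ≡⟨ sym (cong₂ _+ℚ_ (ℚ.p≤q⇒p⊓q≡p a≤1) (ℚ.p≤q⇒p⊓q≡p b≤1)) ⟩
  a ⊓ 1ℚ +ℚ b ⊓ 1ℚ   ∎
  where open ℚ.≤-Reasoning

sumFin-⊓1 : ∀ {f : Fin m → ℚ} → AllNonNegative f → sumFin f ⊓ 1ℚ ≤ℚ sumFin (truncate f)
sumFin-⊓1 {zero}  f≥0 = ℚ.p⊓q≤p 0ℚ 1ℚ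
sumFin-⊓1 {suc m} {f} f≥0 = ℚ.≤-trans
  (⊓1-subadditive (f≥0 zero) (sumFin-nonneg (f≥0 ∘ suc)))
  (ℚ.+-monoʳ-≤ (f zero ⊓ 1ℚ) (sumFin-⊓1 (f≥0 ∘ suc)))

truncate-cover : ∀ {P : Pred (Fin m) 0ℓ} (P? : Decidable P) {f} → AllNonNegative f →
                 1ℚ ≤ℚ sumFin (mask P? f) → 1ℚ ≤ℚ sumFin (mask P? (truncate f))
truncate-cover P? {f} f≥0 covered = begin
  1ℚ                            ≡⟨ sym (ℚ.p≥q⇒p⊓q≡q covered) ⟩
  sumFin (mask P? f) ⊓ 1ℚ       ≤⟨ sumFin-⊓1 (mask-nonneg P? f≥0) ⟩
  sumFin (truncate (mask P? f)) ≤⟨ sumFin-mono (ℚ.≤-reflexive ∘ truncate-mask P? f) ⟩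
  sumFin (mask P? (truncate f)) ∎
  where open ℚ.≤-Reasoning

module _ {n m r} {edge : Fin m → Subset n} {𝐒 : Fin r → Subset m} {U : Subset n} {A : Subset m} where

  ∣A∣≤2^∣U∣-representatives : IsRepresentativeSet edge 𝐒 U A → ∣ A ∣ ℕ.≤ 2 ^ ∣ U ∣
  ∣A∣≤2^∣U∣-representatives rep =
    ∣A∣≤2^∣U∣ (λ a → edge a ∩ U) U A (λ {a} _ → p∩q⊆q (edge a) U) (λ {a} {b} → unique a b)
    where open IsRepresentativeSet rep

  module _ {x : Fin m → ℚ} (feasible : LPFeasible edge 𝐒 U A x) where
    open LPFeasible feasible renaming (outside to vanishes-outside-variables)

    support-truncate⊆variables : support (truncate x) ⊆ ⋃ (tabulate 𝐒) ∪ A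
    support-truncate⊆variables = support-⊆ vanishes
      where
      vanishes : ∀ e → e ∉ ⋃ (tabulate 𝐒) ∪ A → truncate x e ≡ 0ℚ
      vanishes e e∉ = trans (cong (_⊓ 1ℚ) (vanishes-outside-variables e not-variable)) (ℚ.p≤q⇒p⊓q≡p 0≤1)
        where
        not-variable : ¬ InDom 𝐒 A e
        not-variable (inj₁ (_ , e∈𝐒ᵢ)) = e∉ (p⊆p∪q A (∈⋃-tabulate 𝐒 e∈𝐒ᵢ))
        not-variable (inj₂ e∈A)       = e∉ (q⊆p∪q _ A e∈A)

    truncate-covers : ∀ v → In⋃⋂ edge 𝐒 v ⊎ v ∈ U → InB edge (truncate x) v
    truncate-covers v (inj₂ v∈U)       = truncate-cover (λ e → v ∈? edge e) nonneg (coverU v v∈U)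
    truncate-covers v (inj₁ (i , v∈⋂)) = ℚ.≤-trans
      (truncate-cover (_∈? 𝐒 i) nonneg (coverS i))
      (sumFin-mono (mask-mono (_∈? 𝐒 i) (λ e → v ∈? edge e) (v∈⋂ _) (truncate-nonneg nonneg)))

lemma4p3 : (c : ℕ) → c ≥ 1 → (k : ℚ) → (n m r : ℕ)
    → (edge : Fin m → Subset n) → IsHypergraph edge
    → (γ : Fin m → ℚ) → UnitValued γ
    → (𝐒 : Fin r → Subset m) → (U : Subset n) → WellFormed c edge γ 𝐒 U
    → (A : Subset m) → IsRepresentativeSet edge 𝐒 U A
    → LPOptAtMost edge 𝐒 U A k
    → Perfect k edge 𝐒 U
lemma4p3 _ _ k _ _ _ edge _ _ _ 𝐒 U _ A rep (x , feasible , Σx≤k) =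
  truncate x , unit-valued , weight≤k , support-bound , truncate-covers feasible
  where
  open LPFeasible feasible using (nonneg)

  unit-valued : UnitValued (truncate x)
  unit-valued e = truncate-nonneg nonneg e , ℚ.p⊓q≤q (x e) 1ℚ

  weight≤k : weight (truncate x) ≤ℚ k
  weight≤k = ℚ.≤-trans (sumFin-mono (λ e → ℚ.p⊓q≤p (x e) 1ℚ)) Σx≤k

  support-bound : ∣ support (truncate x) ∣ ℕ.≤ size 𝐒 U
  support-bound = begin
    ∣ support (truncate x) ∣              ≤⟨ p⊆q⇒∣p∣≤∣q∣ (support-truncate⊆variables feasible) ⟩
    ∣ ⋃ (tabulate 𝐒) ∪ A ∣                ≤⟨ ∣p∪q∣≤∣p∣+∣q∣ (⋃ (tabulate 𝐒)) A ⟩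
    ∣ ⋃ (tabulate 𝐒) ∣ ℕ.+ ∣ A ∣          ≤⟨ ℕ.+-mono-≤ (∣⋃-tabulate∣≤sumSizes 𝐒)
                                                        (∣A∣≤2^∣U∣-representatives rep) ⟩
    size 𝐒 U                              ∎
    where open ℕ.≤-Reasoning
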